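{- Let $k(d)=d-2$ for $d=1$, $k(d)=d-3$ for $2\le d\le 4$, and $k(d)=d-4$ for $d\ge 5$. For every $d\ge 1$ with $d \neq 5$, there exists a $d$-set ridge cover of $C^d$ in which no set contains a pair of antipodal $(k(d)+1)$-faces. For $d=5$, there exists a $5$-set ridge cover of $C^5$ in which no set contains a pair of antipodal ridges (i.e. antipodal $3$-faces).
   Context: $C^d=[0,1]^d$. A nonempty $k$-face of $C^d$ is given by a word in $\{0,1,X\}^d$ with exactly $k$ letters $X$ (the face is the set of points agreeing with the word in the non-$X$, "fixed", positions). The empty set is regarded as the face of dimension $-1$. Two $k$-faces are antipodal iff they have exactly the same fixed positions and differ in every fixed position. A ridge is a $(d-2)$-face. A $d$-set ridge cover of $C^d$ is a collection of $d$ sets $A_1,\dots,A_d$, each a union of ridges, such that every ridge is contained in at least one $A_i$. A set contains a pair of antipodal $k$-faces if two antipodal $k$-faces are both contained in it.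
   Formalization: Points of the cube $C^d=[0,1]^d$ have rational coordinates, so containment of a face in a set $A_i$ is tested at rational points. -}

module Defs where

open import Data.Nat using (ℕ; zero; suc)
open import Data.Integer using (ℤ; +_; -[1+_]; _+_; _-_)
open import Data.Rational using (ℚ; 0ℚ; 1ℚ; _≤_)
open import Data.Fin using (Fin)
open import Data.Vec using (Vec; []; _∷_; lookup)
open import Data.Maybe using (Maybe; just; nothing)
open import Data.Product using (Σ; _×_; ∃; _,_)
open import Data.Sum using (_⊎_)
open import Data.Unit using (⊤)
open import Data.Empty using (⊥)
open import Relation.Binary.PropositionalEquality using (_≡_)
open import Relation.Nullary using (¬_)
open import Level using () renaming (suc to lsuc; zero to lzero)

-- Letters of a face word: 0, 1, X (free coordinate)
data Letter : Set where
  L0 L1 LX : Letter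

-- Nonempty faces of C^d: words in {0,1,X}^d
Word : ℕ → Set
Word d = Vec Letter d

numX : ∀ {d} → Word d → ℕ
numX [] = 0
numX (LX ∷ w) = suc (numX w)
numX (L0 ∷ w) = numX w
numX (L1 ∷ w) = numX w

-- All faces of C^d: nothing is the empty face (dimension -1)
Face : ℕ → Set
Face d = Maybe (Word d)

dim : ∀ {d} → Face d → ℤ
dim nothing = -[1+ 0 ]
dim (just w) = + numX w

IsRidge : ∀ {d} → Face d → Set
IsRidge {d} F = dim F ≡ (+ d) - (+ 2)

-- Points of the cube (coordinates taken rational)
Point : ℕ → Set
Point d = Fin d → ℚ

InCube : ∀ {d} → Point d → Set
InCube {d} p = ∀ (i : Fin d) → (0ℚ ≤ p i) × (p i ≤ 1ℚ)

Matches : Letter → ℚ → Set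
Matches L0 q = q ≡ 0ℚ
Matches L1 q = q ≡ 1ℚ
Matches LX q = ⊤

InFace : ∀ {d} → Face d → Point d → Set
InFace nothing p = ⊥
InFace {d} (just w) p = InCube p × (∀ (i : Fin d) → Matches (lookup w i) (p i))

-- A union of ridges is given by the family of ridges it is the union of
-- (a predicate on faces, all of whose members are ridges).
RidgeFamily : ℕ → Set₁
RidgeFamily d = Face d → Set

IsRidgeFamily : ∀ {d} → RidgeFamily d → Set
IsRidgeFamily {d} S = ∀ (F : Face d) → S F → IsRidge F

InUnion : ∀ {d} → RidgeFamily d → Point d → Set
InUnion {d} S p = ∃ λ (F : Face d) → S F × InFace F p

ContainedIn : ∀ {d} → Face d → RidgeFamily d → Set
ContainedIn {d} F S = ∀ (p : Point d) → InFace F p → InUnion S p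

Antipodal : ∀ {d} → Word d → Word d → Set
Antipodal {d} v w = ∀ (i : Fin d) →
  ((lookup v i ≡ LX) × (lookup w i ≡ LX)) ⊎
  (((lookup v i ≡ L0) × (lookup w i ≡ L1)) ⊎
   ((lookup v i ≡ L1) × (lookup w i ≡ L0)))

ContainsAntipodalPair : ∀ {d} → ℤ → RidgeFamily d → Set
ContainsAntipodalPair {d} m S =
  ∃ λ (v : Word d) → ∃ λ (w : Word d) →
    (dim (just v) ≡ m) × (dim (just w) ≡ m) × Antipodal v w ×
    ContainedIn (just v) S × ContainedIn (just w) S

IsRidgeCover : (d : ℕ) → (Fin d → RidgeFamily d) → Set
IsRidgeCover d A =
  (∀ (i : Fin d) → IsRidgeFamily (A i)) ×
  (∀ (R : Face d) → IsRidge R → ∃ λ (i : Fin d) → ContainedIn R (A i))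

CoverAvoidingAntipodal : ℕ → ℤ → Set₁
CoverAvoidingAntipodal d m =
  Σ (Fin d → RidgeFamily d) λ A →
    IsRidgeCover d A × (∀ (i : Fin d) → ¬ ContainsAntipodalPair m (A i))

kk : ℕ → ℤ
kk 0 = -[1+ 1 ]          -- irrelevant (d ≥ 1 in the theorem); d - 2
kk 1 = -[1+ 0 ]          -- d - 2
kk 2 = -[1+ 0 ]          -- d - 3
kk 3 = + 0               -- d - 3
kk 4 = + 1               -- d - 3
kk (suc (suc (suc (suc d)))) = + d   -- d ≥ 5 : d - 4

-- A face lies in a union of faces only if it lies in one of them, since its centre lies in no
-- face not containing it. So it suffices to split the ridges into d classes such that no class has
-- two ridges containing a pair of antipodal (k+1)-faces.
-- For 2 ≤ d ≤ 5 these faces are ridges themselves; colour a ridge by the value of its first fixed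
-- coordinate, and antipodal ridges get different colours.
-- For d ≥ 6 take the ridges through each of d vertices forming a binary covering array of
-- strength 2: the rows 0…0 and 1…1 together with the incidence vectors of d - 2 points, the d
-- coordinates being labelled by distinct 2-subsets of these points. Two faces through a common
-- vertex containing antipodal faces v and w have together at least d + dim v free coordinates,
-- which exceeds 2(d - 2) when dim v = d - 3.
-- For d = 1 the only ridge is the empty face.
module Submission where

open import Defs
open import Data.Nat using (ℕ; _≤_)
open import Data.Integer using (+_; _+_)
open import Data.Product using (_×_)
open import Relation.Binary.PropositionalEquality using (_≢_)

open import Data.Bool using (Bool; true; false)
open import Data.Empty using (⊥; ⊥-elim)
open import Data.Fin using (Fin; zero; suc; _≟_; _<_)
import Data.Fin.Properties as Fin
open import Data.Integer.Properties using (+-injective)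
open import Data.List using (List; []; _∷_; length; map)
open import Data.List.Membership.Propositional using (_∈_)
open import Data.List.Membership.Propositional.Properties using (∈-map⁺; ∈-map⁻)
open import Data.List.Relation.Unary.Any using (here; there)
import Data.List.Properties as List
open import Data.Maybe using (just; nothing)
open import Data.Nat using (suc; z≤n; s≤s)
open import Data.Nat.Tactic.RingSolver using (solve-∀)
import Data.Nat as ℕ
import Data.Nat.Properties as ℕₚ
open import Algebra.Properties.CommutativeSemigroup ℕₚ.+-commutativeSemigroup using (interchange)
open import Data.Product using (∃; ∃₂; _,_; proj₁; proj₂; map₂)
open import Data.Rational using (ℚ; 0ℚ; 1ℚ; ½) renaming (_≤_ to _≤ℚ_; _≤?_ to _≤ℚ?_)
import Data.Rational.Properties as ℚ
open import Data.Sum using (_⊎_; inj₁; inj₂)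
open import Data.Unit using (tt)
open import Data.Vec using (_∷_; []; lookup)
open import Function using (_∘_; const; case_of_)
open import Function.Definitions using (Injective)
open import Relation.Binary.PropositionalEquality
  using (_≡_; refl; sym; trans; cong; cong₂; subst; subst₂)
open import Relation.Nullary using (¬_; Dec; yes; no; does)
open import Relation.Nullary.Decidable using (_⊎-dec_; dec-true; dec-false; from-yes)

infix 4 _⊒_ _⊒ʷ_ _∋ᵛ_

data _⊒_ : Letter → Letter → Set where
  X⊒  : ∀ {a} → LX ⊒ a
  0⊒0 : L0 ⊒ L0
  1⊒1 : L1 ⊒ L1

_⊒ʷ_ : ∀ {n} → Word n → Word n → Set
u ⊒ʷ v = ∀ i → lookup u i ⊒ lookup v i

centreCoordinate : Letter → ℚ
centreCoordinate L0 = 0ℚ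
centreCoordinate L1 = 1ℚ
centreCoordinate LX = ½

centre : ∀ {n} → Word n → Point n
centre v i = centreCoordinate (lookup v i)

centre∈face : ∀ {n} (v : Word n) → InFace (just v) (centre v)
centre∈face v = (λ i → inUnitInterval (lookup v i)) , (λ i → matchesCentre (lookup v i))
  where
  inUnitInterval : ∀ a → (0ℚ ≤ℚ centreCoordinate a) × (centreCoordinate a ≤ℚ 1ℚ)
  inUnitInterval L0 = ℚ.≤-refl , from-yes (0ℚ ≤ℚ? 1ℚ)
  inUnitInterval L1 = from-yes (0ℚ ≤ℚ? 1ℚ) , ℚ.≤-refl
  inUnitInterval LX = from-yes (0ℚ ≤ℚ? ½) , from-yes (½ ≤ℚ? 1ℚ)

  matchesCentre : ∀ a → Matches a (centreCoordinate a)
  matchesCentre L0 = refl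
  matchesCentre L1 = refl
  matchesCentre LX = tt

matches-centre⇒⊒ : ∀ a b → Matches a (centreCoordinate b) → a ⊒ b
matches-centre⇒⊒ LX b _ = X⊒
matches-centre⇒⊒ L0 L0 _ = 0⊒0
matches-centre⇒⊒ L1 L1 _ = 1⊒1
matches-centre⇒⊒ L0 L1 ()
matches-centre⇒⊒ L0 LX ()
matches-centre⇒⊒ L1 L0 ()
matches-centre⇒⊒ L1 LX ()

containedIn⇒below-member : ∀ {n} {S : RidgeFamily n} (v : Word n) → ContainedIn (just v) S →
  ∃ λ u → S (just u) × u ⊒ʷ v
containedIn⇒below-member v v⊆S with v⊆S (centre v) (centre∈face v)
... | just u , u∈S , (_ , matches) =
  u , u∈S , λ i → matches-centre⇒⊒ (lookup u i) (lookup v i) (matches i)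

member⇒containedIn : ∀ {n} {S : RidgeFamily n} (F : Face n) → S F → ContainedIn F S
member⇒containedIn F F∈S p p∈F = F , F∈S , p∈F

numX-mono : ∀ {n} {u v : Word n} → u ⊒ʷ v → numX v ≤ numX u
numX-mono {u = []} {[]} _ = z≤n
numX-mono {u = a ∷ u} {b ∷ v} u⊒v = step (u⊒v zero) (numX-mono {u = u} {v} (u⊒v ∘ suc))
  where
  step : ∀ {a b} → a ⊒ b → numX v ≤ numX u → numX (b ∷ v) ≤ numX (a ∷ u)
  step (X⊒ {LX}) le = s≤s le
  step (X⊒ {L0}) le = ℕₚ.m≤n⇒m≤1+n le
  step (X⊒ {L1}) le = ℕₚ.m≤n⇒m≤1+n le
  step 0⊒0 le = le
  step 1⊒1 le = le

⊒ʷ-numX-≡⇒≡ : ∀ {n} {u v : Word n} → u ⊒ʷ v → numX u ≡ numX v → u ≡ v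
⊒ʷ-numX-≡⇒≡ {u = []} {[]} _ _ = refl
⊒ʷ-numX-≡⇒≡ {u = a ∷ u} {b ∷ v} u⊒v = step (u⊒v zero)
  where
  tail-eq : numX u ≡ numX v → u ≡ v
  tail-eq = ⊒ʷ-numX-≡⇒≡ {u = u} {v} (u⊒v ∘ suc)

  1+numX-u≢numX-v : suc (numX u) ≢ numX v
  1+numX-u≢numX-v eq = ℕₚ.<-irrefl (sym eq) (s≤s (numX-mono {u = u} {v} (u⊒v ∘ suc)))

  step : ∀ {a b} → a ⊒ b → numX (a ∷ u) ≡ numX (b ∷ v) → a ∷ u ≡ b ∷ v
  step (X⊒ {LX}) eq = cong (LX ∷_) (tail-eq (ℕₚ.suc-injective eq))
  step (X⊒ {L0}) eq = ⊥-elim (1+numX-u≢numX-v eq)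
  step (X⊒ {L1}) eq = ⊥-elim (1+numX-u≢numX-v eq)
  step 0⊒0 eq = cong (L0 ∷_) (tail-eq eq)
  step 1⊒1 eq = cong (L1 ∷_) (tail-eq eq)

AntipodalBelow : ∀ {n} → ℕ → Word n → Word n → Set
AntipodalBelow {n} m u u' = ∃₂ λ (v w : Word n) →
  Antipodal v w × numX v ≡ m × numX w ≡ m × u ⊒ʷ v × u' ⊒ʷ w

ridgesIn : ∀ {k} → (Fin (2 ℕ.+ k) → Word (2 ℕ.+ k) → Set) → Fin (2 ℕ.+ k) → RidgeFamily (2 ℕ.+ k)
ridgesIn Class i nothing = ⊥
ridgesIn {k} Class i (just u) = numX u ≡ k × Class i u

classCover : ∀ {k} m (Class : Fin (2 ℕ.+ k) → Word (2 ℕ.+ k) → Set) →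
  (∀ u → numX u ≡ k → ∃ λ i → Class i u) →
  (∀ i {u u'} → numX u ≡ k → numX u' ≡ k → Class i u → Class i u' → ¬ AntipodalBelow m u u') →
  CoverAvoidingAntipodal (2 ℕ.+ k) (+ m)
classCover {k} m Class classify separated = ridgesIn Class , (isRidgeFamily , covers) , avoids
  where
  isRidgeFamily : ∀ i → IsRidgeFamily (ridgesIn Class i)
  isRidgeFamily i (just u) (ridge , _) = cong +_ ridge

  covers : ∀ R → IsRidge R → ∃ λ i → ContainedIn R (ridgesIn Class i)
  covers (just u) ridge with classify u (+-injective ridge)
  ... | i , u∈Class = i , member⇒containedIn (just u) (+-injective ridge , u∈Class)

  avoids : ∀ i → ¬ ContainsAntipodalPair (+ m) (ridgesIn Class i)
  avoids i (v , w , dim-v , dim-w , anti , v⊆ , w⊆)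
    with containedIn⇒below-member v v⊆ | containedIn⇒below-member w w⊆
  ... | u , (ridge-u , u∈Class) , u⊒v | u' , (ridge-u' , u'∈Class) , u'⊒w =
    separated i ridge-u ridge-u' u∈Class u'∈Class
      (v , w , anti , +-injective dim-v , +-injective dim-w , u⊒v , u'⊒w)

firstFixed : ∀ {n} → Word n → Letter
firstFixed [] = LX
firstFixed (LX ∷ w) = firstFixed w
firstFixed (L0 ∷ w) = L0
firstFixed (L1 ∷ w) = L1

firstFixed≡LX⇒numX≡ : ∀ {n} (w : Word n) → firstFixed w ≡ LX → numX w ≡ n
firstFixed≡LX⇒numX≡ [] _ = refl
firstFixed≡LX⇒numX≡ (LX ∷ w) eq = cong suc (firstFixed≡LX⇒numX≡ w eq)

firstFixed-antipodal : ∀ {n} (v w : Word n) → Antipodal v w → numX v ≢ n →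
  firstFixed v ≢ firstFixed w
firstFixed-antipodal [] [] _ proper = ⊥-elim (proper refl)
firstFixed-antipodal (a ∷ v) (b ∷ w) anti proper with anti zero
... | inj₁ (refl , refl) = firstFixed-antipodal v w (anti ∘ suc) (proper ∘ cong suc)
... | inj₂ (inj₁ (refl , refl)) = λ ()
... | inj₂ (inj₂ (refl , refl)) = λ ()

-- The classes beyond the first two stay empty: a ridge always has a fixed coordinate.
colourLetter : ∀ {k} → Fin (2 ℕ.+ k) → Letter
colourLetter zero = L0
colourLetter (suc zero) = L1
colourLetter (suc (suc _)) = LX

firstFixedCover : ∀ k → CoverAvoidingAntipodal (2 ℕ.+ k) (+ k)
firstFixedCover k = classCover k (λ i u → firstFixed u ≡ colourLetter i) colour separated
  where
  k≢2+k : k ≢ 2 ℕ.+ k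
  k≢2+k = ℕₚ.m≢1+n+m k {1}

  colour : ∀ u → numX u ≡ k → ∃ λ i → firstFixed u ≡ colourLetter i
  colour u ridge with firstFixed u in eq
  ... | L0 = zero , refl
  ... | L1 = suc zero , refl
  ... | LX = ⊥-elim (k≢2+k (trans (sym ridge) (firstFixed≡LX⇒numX≡ u eq)))

  separated : ∀ i {u u'} → numX u ≡ k → numX u' ≡ k →
    firstFixed u ≡ colourLetter i → firstFixed u' ≡ colourLetter i → ¬ AntipodalBelow k u u'
  separated i {u} {u'} ridge-u ridge-u' colour-u colour-u' (v , w , anti , dim-v , dim-w , u⊒v , u'⊒w)
    with ⊒ʷ-numX-≡⇒≡ {u = u} {v} u⊒v (trans ridge-u (sym dim-v))
       | ⊒ʷ-numX-≡⇒≡ {u = u'} {w} u'⊒w (trans ridge-u' (sym dim-w))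
  ... | refl | refl =
    firstFixed-antipodal v w anti (k≢2+k ∘ trans (sym dim-v)) (trans colour-u (sym colour-u'))

Vertex : ℕ → Set
Vertex n = Fin n → Bool

bitLetter : Bool → Letter
bitLetter false = L0
bitLetter true = L1

bitLetter-injective : ∀ {x y} → bitLetter x ≡ bitLetter y → x ≡ y
bitLetter-injective {false} {false} _ = refl
bitLetter-injective {true} {true} _ = refl

_∋ᵛ_ : ∀ {n} → Word n → Vertex n → Set
u ∋ᵛ s = ∀ i → lookup u i ⊒ bitLetter (s i)

xcount : Letter → ℕ
xcount LX = 1
xcount L0 = 0
xcount L1 = 0

numX-∷ : ∀ {n} a (w : Word n) → numX (a ∷ w) ≡ xcount a ℕ.+ numX w
numX-∷ LX w = refl
numX-∷ L0 w = refl
numX-∷ L1 w = refl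

-- a and a' both admit the value z, so they cannot be the opposite fixed letters b and b'.
xcount-through-vertex : ∀ {a a' b b'} z → a ⊒ b → a' ⊒ b' → a ⊒ bitLetter z → a' ⊒ bitLetter z →
  (b ≡ LX × b' ≡ LX) ⊎ ((b ≡ L0 × b' ≡ L1) ⊎ (b ≡ L1 × b' ≡ L0)) →
  xcount b ℕ.+ 1 ≤ xcount a ℕ.+ xcount a'
xcount-through-vertex z X⊒ X⊒ _ _ (inj₁ (refl , refl)) = ℕₚ.≤-refl
xcount-through-vertex z X⊒ _ _ _ (inj₂ (inj₁ (refl , refl))) = s≤s z≤n
xcount-through-vertex z X⊒ _ _ _ (inj₂ (inj₂ (refl , refl))) = s≤s z≤n
xcount-through-vertex z 0⊒0 X⊒ _ _ _ = s≤s z≤n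
xcount-through-vertex z 1⊒1 X⊒ _ _ _ = s≤s z≤n
xcount-through-vertex false 0⊒0 1⊒1 _ () _
xcount-through-vertex true 0⊒0 1⊒1 () _ _
xcount-through-vertex false 1⊒1 0⊒0 () _ _
xcount-through-vertex true 1⊒1 0⊒0 _ () _
xcount-through-vertex z 0⊒0 0⊒0 _ _ (inj₁ (() , _))
xcount-through-vertex z 0⊒0 0⊒0 _ _ (inj₂ (inj₁ (_ , ())))
xcount-through-vertex z 0⊒0 0⊒0 _ _ (inj₂ (inj₂ (() , _)))
xcount-through-vertex z 1⊒1 1⊒1 _ _ (inj₁ (() , _))
xcount-through-vertex z 1⊒1 1⊒1 _ _ (inj₂ (inj₁ (() , _)))
xcount-through-vertex z 1⊒1 1⊒1 _ _ (inj₂ (inj₂ (_ , ())))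

numX-through-vertex : ∀ {n} (s : Vertex n) {u u' v w : Word n} → u ∋ᵛ s → u' ∋ᵛ s →
  u ⊒ʷ v → u' ⊒ʷ w → Antipodal v w → numX v ℕ.+ n ≤ numX u ℕ.+ numX u'
numX-through-vertex s {[]} {[]} {[]} {[]} _ _ _ _ _ = z≤n
numX-through-vertex {suc n} s {a ∷ u} {a' ∷ u'} {b ∷ v} {b' ∷ w} s∈u s∈u' u⊒v u'⊒w anti = begin
  numX (b ∷ v) ℕ.+ suc n                       ≡⟨ cong (ℕ._+ suc n) (numX-∷ b v) ⟩
  (xcount b ℕ.+ numX v) ℕ.+ (1 ℕ.+ n)          ≡⟨ interchange (xcount b) (numX v) 1 n ⟩
  (xcount b ℕ.+ 1) ℕ.+ (numX v ℕ.+ n)          ≤⟨ ℕₚ.+-mono-≤ head tail ⟩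
  (xcount a ℕ.+ xcount a') ℕ.+ (numX u ℕ.+ numX u') ≡⟨ interchange (xcount a) (xcount a') (numX u) (numX u') ⟩
  (xcount a ℕ.+ numX u) ℕ.+ (xcount a' ℕ.+ numX u') ≡⟨ sym (cong₂ ℕ._+_ (numX-∷ a u) (numX-∷ a' u')) ⟩
  numX (a ∷ u) ℕ.+ numX (a' ∷ u')              ∎
  where
  open ℕₚ.≤-Reasoning
  head : xcount b ℕ.+ 1 ≤ xcount a ℕ.+ xcount a'
  head = xcount-through-vertex (s zero) (u⊒v zero) (u'⊒w zero) (s∈u zero) (s∈u' zero) (anti zero)
  tail : numX v ℕ.+ n ≤ numX u ℕ.+ numX u'
  tail = numX-through-vertex (s ∘ suc) {u} {u'} {v} {w}
           (s∈u ∘ suc) (s∈u' ∘ suc) (u⊒v ∘ suc) (u'⊒w ∘ suc) (anti ∘ suc)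

shiftCoordinate : ∀ {n} → Fin n × Bool → Fin (suc n) × Bool
shiftCoordinate (c , x) = suc c , x

fixedCoordinates : ∀ {n} → Word n → List (Fin n × Bool)
fixedCoordinates [] = []
fixedCoordinates (LX ∷ w) = map shiftCoordinate (fixedCoordinates w)
fixedCoordinates (L0 ∷ w) = (zero , false) ∷ map shiftCoordinate (fixedCoordinates w)
fixedCoordinates (L1 ∷ w) = (zero , true) ∷ map shiftCoordinate (fixedCoordinates w)

length-fixedCoordinates : ∀ {n} (w : Word n) → length (fixedCoordinates w) ℕ.+ numX w ≡ n
length-shifted : ∀ {n} (w : Word n) →
  length (map shiftCoordinate (fixedCoordinates w)) ℕ.+ numX w ≡ n

length-fixedCoordinates [] = refl
length-fixedCoordinates (LX ∷ w) =
  trans (ℕₚ.+-suc (length (map shiftCoordinate (fixedCoordinates w))) (numX w))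
        (cong suc (length-shifted w))
length-fixedCoordinates (L0 ∷ w) = cong suc (length-shifted w)
length-fixedCoordinates (L1 ∷ w) = cong suc (length-shifted w)

length-shifted w = trans (cong (ℕ._+ numX w) (List.length-map shiftCoordinate (fixedCoordinates w)))
                         (length-fixedCoordinates w)

∈-fixedCoordinates⁺ : ∀ {n} (w : Word n) c x → lookup w c ≡ bitLetter x → (c , x) ∈ fixedCoordinates w
∈-fixedCoordinates⁺ (L0 ∷ w) zero false _ = here refl
∈-fixedCoordinates⁺ (L1 ∷ w) zero true _ = here refl
∈-fixedCoordinates⁺ (LX ∷ w) zero false ()
∈-fixedCoordinates⁺ (LX ∷ w) zero true ()
∈-fixedCoordinates⁺ (LX ∷ w) (suc c) x eq = ∈-map⁺ shiftCoordinate (∈-fixedCoordinates⁺ w c x eq)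
∈-fixedCoordinates⁺ (L0 ∷ w) (suc c) x eq = there (∈-map⁺ shiftCoordinate (∈-fixedCoordinates⁺ w c x eq))
∈-fixedCoordinates⁺ (L1 ∷ w) (suc c) x eq = there (∈-map⁺ shiftCoordinate (∈-fixedCoordinates⁺ w c x eq))

∈-fixedCoordinates⁻ : ∀ {n} (w : Word n) {c x} → (c , x) ∈ fixedCoordinates w → lookup w c ≡ bitLetter x
∈-fixedCoordinates⁻ (LX ∷ w) c∈ with ∈-map⁻ shiftCoordinate c∈
... | _ , c'∈ , refl = ∈-fixedCoordinates⁻ w c'∈
∈-fixedCoordinates⁻ (L0 ∷ w) (here refl) = refl
∈-fixedCoordinates⁻ (L1 ∷ w) (here refl) = refl
∈-fixedCoordinates⁻ (L0 ∷ w) (there c∈) with ∈-map⁻ shiftCoordinate c∈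
... | _ , c'∈ , refl = ∈-fixedCoordinates⁻ w c'∈
∈-fixedCoordinates⁻ (L1 ∷ w) (there c∈) with ∈-map⁻ shiftCoordinate c∈
... | _ , c'∈ , refl = ∈-fixedCoordinates⁻ w c'∈

∋ᵛ-from-fixedCoordinates : ∀ {n} (u : Word n) (s : Vertex n) →
  (∀ {c x} → (c , x) ∈ fixedCoordinates u → s c ≡ x) → u ∋ᵛ s
∋ᵛ-from-fixedCoordinates u s agrees c with lookup u c in eq
... | LX = X⊒
... | L0 rewrite agrees (∈-fixedCoordinates⁺ u c false eq) = 0⊒0
... | L1 rewrite agrees (∈-fixedCoordinates⁺ u c true eq) = 1⊒1

CoversPairs : ∀ {r n} → (Fin r → Vertex n) → Set
CoversPairs {n = n} V = ∀ (a b : Fin n) x y → (a ≡ b → x ≡ y) → ∃ λ i → V i a ≡ x × V i b ≡ y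

twoFixed⇒∋ᵛ : ∀ {r n} {V : Fin r → Vertex n} → CoversPairs V →
  (u : Word n) → length (fixedCoordinates u) ≡ 2 → ∃ λ i → u ∋ᵛ V i
twoFixed⇒∋ᵛ {n = n} {V} covers u two =
  map₂ (λ {i} → ∋ᵛ-from-fixedCoordinates u (V i))
       (rowAgreeing (fixedCoordinates u) two (∈-fixedCoordinates⁻ u))
  where
  rowAgreeing : (l : List (Fin n × Bool)) → length l ≡ 2 →
    (∀ {c x} → (c , x) ∈ l → lookup u c ≡ bitLetter x) →
    ∃ λ i → ∀ {c x} → (c , x) ∈ l → V i c ≡ x
  rowAgreeing ((a , x) ∷ (b , y) ∷ []) _ fixed =
    let i , Vᵢa≡x , Vᵢb≡y = covers a b x y consistent
    in i , λ { (here refl) → Vᵢa≡x ; (there (here refl)) → Vᵢb≡y }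
    where
    consistent : a ≡ b → x ≡ y
    consistent refl = bitLetter-injective (trans (sym (fixed (here refl))) (fixed (there (here refl))))

vertexStarCover : ∀ {m} (V : Fin (3 ℕ.+ m) → Vertex (3 ℕ.+ m)) → CoversPairs V →
  CoverAvoidingAntipodal (3 ℕ.+ m) (+ m)
vertexStarCover {m} V covers = classCover m (λ i u → u ∋ᵛ V i) star separated
  where
  star : ∀ u → numX u ≡ suc m → ∃ λ i → u ∋ᵛ V i
  star u ridge = twoFixed⇒∋ᵛ covers u
    (ℕₚ.+-cancelʳ-≡ (suc m) (length (fixedCoordinates u)) 2
      (trans (cong (length (fixedCoordinates u) ℕ.+_) (sym ridge)) (length-fixedCoordinates u)))

  m+[3+m]≡1+[1+m]+[1+m] : ∀ n → n ℕ.+ (3 ℕ.+ n) ≡ suc (suc n ℕ.+ suc n)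
  m+[3+m]≡1+[1+m]+[1+m] = solve-∀

  separated : ∀ i {u u'} → numX u ≡ suc m → numX u' ≡ suc m → u ∋ᵛ V i → u' ∋ᵛ V i →
    ¬ AntipodalBelow m u u'
  separated i {u} {u'} ridge-u ridge-u' s∈u s∈u' (v , w , anti , dim-v , _ , u⊒v , u'⊒w) =
    ℕₚ.<-irrefl refl (subst₂ _≤_ (trans (cong (ℕ._+ (3 ℕ.+ m)) dim-v) (m+[3+m]≡1+[1+m]+[1+m] m))
                                  (cong₂ ℕ._+_ ridge-u ridge-u')
                                  (numX-through-vertex (V i) {u} {u'} {v} {w} s∈u s∈u' u⊒v u'⊒w anti))

Separates : ∀ {t n} → (Fin t → Vertex n) → Set
Separates {n = n} M = ∀ (a b : Fin n) → a ≢ b → ∃ λ i → M i a ≡ true × M i b ≡ false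

withConstantRows : ∀ {t n} → (Fin t → Vertex n) → Fin (2 ℕ.+ t) → Vertex n
withConstantRows M zero = const false
withConstantRows M (suc zero) = const true
withConstantRows M (suc (suc i)) = M i

withConstantRows-coversPairs : ∀ {t n} {M : Fin t → Vertex n} → Separates M →
  CoversPairs (withConstantRows M)
withConstantRows-coversPairs separates a b false false _ = zero , refl , refl
withConstantRows-coversPairs separates a b true true _ = suc zero , refl , refl
withConstantRows-coversPairs separates a b true false consistent
  with separates a b (λ a≡b → case consistent a≡b of λ ())
... | i , Mᵢa , Mᵢb = suc (suc i) , Mᵢa , Mᵢb
withConstantRows-coversPairs separates a b false true consistent
  with separates b a (λ b≡a → case consistent (sym b≡a) of λ ())
... | i , Mᵢb , Mᵢa = suc (suc i) , Mᵢa , Mᵢb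

InPair : ∀ {t} → Fin t → Fin t × Fin t → Set
InPair i (p , q) = i ≡ p ⊎ i ≡ q

inPair? : ∀ {t} (i : Fin t) pq → Dec (InPair i pq)
inPair? i (p , q) = (i ≟ p) ⊎-dec (i ≟ q)

incidence : ∀ {t n} → (Fin n → Fin t × Fin t) → Fin t → Vertex n
incidence label i c = does (inPair? i (label c))

ordered-pairs-separate : ∀ {t} {p q p' q' : Fin t} → p < q → p' < q' → (p , q) ≢ (p' , q') →
  ∃ λ i → InPair i (p , q) × ¬ InPair i (p' , q')
ordered-pairs-separate {p = p} {q} {p'} {q'} p<q p'<q' distinct
  with inPair? p (p' , q') | inPair? q (p' , q')
... | no p∉ | _ = p , inj₁ refl , p∉
... | yes _ | no q∉ = q , inj₂ refl , q∉
... | yes (inj₁ refl) | yes (inj₁ refl) = ⊥-elim (Fin.<-irrefl refl p<q)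
... | yes (inj₁ refl) | yes (inj₂ refl) = ⊥-elim (distinct refl)
... | yes (inj₂ refl) | yes (inj₁ refl) = ⊥-elim (Fin.<-asym p<q p'<q')
... | yes (inj₂ refl) | yes (inj₂ refl) = ⊥-elim (Fin.<-irrefl refl p<q)

incidence-separates : ∀ {t n} (label : Fin n → Fin t × Fin t) →
  (∀ c → proj₁ (label c) < proj₂ (label c)) → Injective _≡_ _≡_ label →
  Separates (incidence label)
incidence-separates label ordered injective a b a≢b
  with ordered-pairs-separate (ordered a) (ordered b) (a≢b ∘ injective)
... | i , i∈a , i∉b = i , dec-true (inPair? i (label a)) i∈a , dec-false (inPair? i (label b)) i∉b

twoSubsetLabel : ∀ {e} → Fin (6 ℕ.+ e) → Fin (4 ℕ.+ e) × Fin (4 ℕ.+ e)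
twoSubsetLabel zero = zero , suc zero
twoSubsetLabel (suc zero) = zero , suc (suc zero)
twoSubsetLabel (suc (suc zero)) = zero , suc (suc (suc zero))
twoSubsetLabel (suc (suc (suc zero))) = suc zero , suc (suc zero)
twoSubsetLabel (suc (suc (suc (suc zero)))) = suc zero , suc (suc (suc zero))
twoSubsetLabel (suc (suc (suc (suc (suc zero))))) = suc (suc zero) , suc (suc (suc zero))
twoSubsetLabel (suc (suc (suc (suc (suc (suc j)))))) = zero , suc (suc (suc (suc j)))

twoSubsetLabel-ordered : ∀ {e} (c : Fin (6 ℕ.+ e)) →
  proj₁ (twoSubsetLabel c) < proj₂ (twoSubsetLabel c)
twoSubsetLabel-ordered zero = ℕ.z<s
twoSubsetLabel-ordered (suc zero) = ℕ.z<s
twoSubsetLabel-ordered (suc (suc zero)) = ℕ.z<s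
twoSubsetLabel-ordered (suc (suc (suc zero))) = ℕ.s<s ℕ.z<s
twoSubsetLabel-ordered (suc (suc (suc (suc zero)))) = ℕ.s<s ℕ.z<s
twoSubsetLabel-ordered (suc (suc (suc (suc (suc zero))))) = ℕ.s<s (ℕ.s<s ℕ.z<s)
twoSubsetLabel-ordered (suc (suc (suc (suc (suc (suc j)))))) = ℕ.z<s

labelledCoordinate : ∀ {e} → Fin (4 ℕ.+ e) × Fin (4 ℕ.+ e) → Fin (6 ℕ.+ e)
labelledCoordinate (zero , suc zero) = zero
labelledCoordinate (zero , suc (suc zero)) = suc zero
labelledCoordinate (zero , suc (suc (suc zero))) = suc (suc zero)
labelledCoordinate (suc zero , suc (suc zero)) = suc (suc (suc zero))
labelledCoordinate (suc zero , suc (suc (suc zero))) = suc (suc (suc (suc zero)))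
labelledCoordinate (suc (suc zero) , suc (suc (suc zero))) = suc (suc (suc (suc (suc zero))))
labelledCoordinate (zero , suc (suc (suc (suc j)))) = suc (suc (suc (suc (suc (suc j)))))
labelledCoordinate _ = zero

labelledCoordinate-twoSubsetLabel : ∀ {e} (c : Fin (6 ℕ.+ e)) →
  labelledCoordinate (twoSubsetLabel c) ≡ c
labelledCoordinate-twoSubsetLabel zero = refl
labelledCoordinate-twoSubsetLabel (suc zero) = refl
labelledCoordinate-twoSubsetLabel (suc (suc zero)) = refl
labelledCoordinate-twoSubsetLabel (suc (suc (suc zero))) = refl
labelledCoordinate-twoSubsetLabel (suc (suc (suc (suc zero)))) = refl
labelledCoordinate-twoSubsetLabel (suc (suc (suc (suc (suc zero))))) = refl
labelledCoordinate-twoSubsetLabel (suc (suc (suc (suc (suc (suc j)))))) = refl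

twoSubsetLabel-injective : ∀ {e} → Injective _≡_ _≡_ (twoSubsetLabel {e})
twoSubsetLabel-injective {x = a} {b} eq =
  trans (sym (labelledCoordinate-twoSubsetLabel a))
        (trans (cong labelledCoordinate eq) (labelledCoordinate-twoSubsetLabel b))

highDimensionCover : ∀ e → CoverAvoidingAntipodal (6 ℕ.+ e) (kk (6 ℕ.+ e) + + 1)
highDimensionCover e =
  subst (CoverAvoidingAntipodal (6 ℕ.+ e)) (cong +_ (ℕₚ.+-comm 1 (2 ℕ.+ e)))
    (vertexStarCover (withConstantRows (incidence twoSubsetLabel))
      (withConstantRows-coversPairs
        (incidence-separates twoSubsetLabel twoSubsetLabel-ordered twoSubsetLabel-injective)))

dimensionOneCover : CoverAvoidingAntipodal 1 (+ 0)
dimensionOneCover =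
  (λ _ → IsRidge) , ((λ _ _ ridge → ridge) , λ R ridge → zero , member⇒containedIn R ridge) , noPair
  where
  noPair : ∀ i → ¬ ContainsAntipodalPair (+ 0) IsRidge
  noPair i (v , _ , _ , _ , _ , v⊆ , _) with containedIn⇒below-member v v⊆
  ... | u , () , _

theorem5 : ((d : ℕ) → 1 ≤ d → d ≢ 5 → CoverAvoidingAntipodal d (kk d + + 1))
    × CoverAvoidingAntipodal 5 (+ 3)
theorem5 = cover , firstFixedCover 3
  where
  cover : (d : ℕ) → 1 ≤ d → d ≢ 5 → CoverAvoidingAntipodal d (kk d + + 1)
  cover 0 ()
  cover 1 _ _ = dimensionOneCover
  cover 2 _ _ = firstFixedCover 0
  cover 3 _ _ = firstFixedCover 1
  cover 4 _ _ = firstFixedCover 2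
  cover 5 _ d≢5 = ⊥-elim (d≢5 refl)
  cover (suc (suc (suc (suc (suc (suc e)))))) _ _ = highDimensionCover e
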